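{- Let $P,Q\in\mathbb{Z}$ with $PQ\neq 0$ and let $R\in\mathbb{Q}\setminus\mathbb{Z}$. If every prime dividing the denominator of $R$ (in lowest terms) is regular, i.e. does not divide $\gcd(P,Q)$, then $\mathcal{L}(P,Q,R)$ is either $\{0\}$ or $\langle m\rangle=m\mathbb{N}$ for some $m\geq 2$. Moreover, $\{0\}$ and each $\langle m\rangle$ with $m\geq 2$ arises in this manner, and each of these semigroups is dimension-$2$ realizable.
   Context: $\mathbb{N}=\{0,1,2,\ldots\}$. For $P,Q\in\mathbb{Z}$, the Lucas sequence $U_n=U_n(P,Q)$ is defined by $U_0=0$, $U_1=1$, $U_{n+2}=PU_{n+1}-QU_n$. For $R\in\mathbb{Q}$, $\mathcal{L}(P,Q,R)=\{n\in\mathbb{N} : U_nR\in\mathbb{Z}\}$. For $A\in\mathrm{M}_d(\mathbb{Q})$, $\mathcal{S}(A)=\{n\in\mathbb{N}: A^n\in\mathrm{M}_d(\mathbb{Z})\}$; a semigroup $S\subseteq\mathbb{N}$ is dimension-$d$ realizable if $S=\mathcal{S}(A)$ for some $A\in\mathrm{M}_d(\mathbb{Q})$. -}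

module Defs where

open import Data.Nat as ℕ using (ℕ; zero; suc; _≤_)
open import Data.Nat.Divisibility as ℕD using ()
open import Data.Nat.Primality using (Prime)
open import Data.Integer as ℤ using (ℤ; +_)
open import Data.Integer.GCD using (gcd)
open import Data.Integer.Divisibility as ℤD using ()
open import Data.Rational as ℚ using (ℚ; 0ℚ; 1ℚ)
open import Data.Fin using (Fin; zero; suc)
open import Data.Product using (Σ; _×_)
open import Data.Empty using (⊥)
open import Relation.Nullary using (¬_)
open import Relation.Binary.PropositionalEquality using (_≡_; _≢_)

U : ℤ → ℤ → ℕ → ℤ
U P Q zero = + 0
U P Q (suc zero) = + 1
U P Q (suc (suc n)) = (P ℤ.* U P Q (suc n)) ℤ.- (Q ℤ.* U P Q n)

toℚ : ℤ → ℚ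
toℚ z = z ℚ./ 1

-- a rational (always stored in lowest terms) is an integer iff its denominator is 1
IsInt : ℚ → Set
IsInt q = ℚ.denominatorℕ q ≡ 1

Subset : Set₁
Subset = ℕ → Set

_≐_ : Subset → Subset → Set
A ≐ B = ∀ n → (A n → B n) × (B n → A n)

Zero : Subset
Zero n = n ≡ 0

Mult : ℕ → Subset
Mult m n = m ℕD.∣ n

𝓛 : ℤ → ℤ → ℚ → Subset
𝓛 P Q R n = IsInt (toℚ (U P Q n) ℚ.* R)

Hyp : ℤ → ℤ → ℚ → Set
Hyp P Q R =
  (P ℤ.* Q ≢ + 0)
  × (¬ IsInt R)
  × (∀ p → Prime p → p ℕD.∣ ℚ.denominatorℕ R → ¬ (+ p ℤD.∣ gcd P Q))

Mat : ℕ → Set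
Mat d = Fin d → Fin d → ℚ

sumFin : ∀ {d} → (Fin d → ℚ) → ℚ
sumFin {zero} f = 0ℚ
sumFin {suc d} f = f zero ℚ.+ sumFin (λ i → f (suc i))

_⊗_ : ∀ {d} → Mat d → Mat d → Mat d
(A ⊗ B) i j = sumFin (λ k → A i k ℚ.* B k j)

idMat : ∀ {d} → Mat d
idMat zero zero = 1ℚ
idMat zero (suc j) = 0ℚ
idMat (suc i) zero = 0ℚ
idMat (suc i) (suc j) = idMat i j

_^ᴹ_ : ∀ {d} → Mat d → ℕ → Mat d
A ^ᴹ zero = idMat
A ^ᴹ suc n = A ⊗ (A ^ᴹ n)

𝓢 : ∀ {d} → Mat d → Subset
𝓢 A n = ∀ i j → IsInt ((A ^ᴹ n) i j)

Realizable : ℕ → Subset → Set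
Realizable d S = Σ (Mat d) (λ A → S ≐ 𝓢 A)

Arises : Subset → Set
Arises S = Σ ℤ (λ P → Σ ℤ (λ Q → Σ ℚ (λ R → Hyp P Q R × (𝓛 P Q R ≐ S))))

-- Let b be the denominator of R. As R is in lowest terms, U n · R ∈ ℤ iff b ∣ U n.
--
-- If b is coprime to Q, the recurrence U (n+2) = P U (n+1) - Q U n can be run backwards
-- modulo b, so the pairs (U n, U (n+1)) mod b are purely periodic and b divides some
-- U (1+m). The addition formula U (1+m+n) = U (1+m) U (1+n) - Q U m U n then shows that
-- b ∣ U n iff 1+m ∣ n for the least such m, and 1+m ≥ 2 because U 1 = 1 and b ≠ 1.
-- Otherwise a prime p divides both b and Q; by regularity p ∤ P, and U (1+n) ≡ Pⁿ (mod p)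
-- is never divisible by p, so only n = 0 is left.
--
-- The examples are (P, Q, R) = (1, 2, 1/2) and (2, 1, 1/m), where U n = n; the matrices are
-- the unitriangular [[1, 1/m], [0, 1]] and the idempotent [[1, 1/2], [0, 0]].

module Submission where

open import Data.Empty using (⊥-elim)
open import Data.Fin as Fin using (Fin; zero; suc; toℕ; fromℕ<; combine)
import Data.Fin.Properties as Finₚ
open import Data.Integer as ℤ using (ℤ; +_; _%ℕ_; _/ℕ_)
import Data.Integer.DivMod as ℤ
import Data.Integer.GCD
import Data.Integer.Properties as ℤₚ
open import Data.Integer.Divisibility.Signed as ℤ∣ using () renaming (_∣_ to _∣ℤ_)
open import Data.Integer.Tactic.RingSolver using (solve-∀)
open import Data.List using ([]; _∷_)
open import Data.List.Relation.Unary.All using (_∷_)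
open import Data.Nat as ℕ using (ℕ; zero; suc; _≤_; _<_; z≤n; s≤s; NonZero)
open import Data.Nat.Coprimality as Coprimality
  using (Coprime; coprime?; coprime-divisor; gcd≡1⇒coprime)
open import Data.Nat.Divisibility
  using (_∣_; divides; ∣-trans; ∣-refl; ∣-antisym; ∣1⇒≡1; _∣0; m∣m*n; ∣m⇒∣m*n; m%n≡0⇒n∣m)
open import Data.Nat.DivMod using (_%_; _/_; m≡m%n+[m/n]*n; m%n<n)
open import Data.Nat.GCD using (gcd; gcd[m,n]∣m; gcd[m,n]∣n; gcd-greatest; gcd[m,n]≢0; gcd-zeroˡ)
open import Data.Nat.Induction using (<-rec)
import Data.Nat.Properties as ℕₚ
open import Data.Nat.Primality using (Prime; prime[2]; ¬prime[1]; euclidsLemma)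
open import Data.Nat.Primality.Factorisation using (factorise)
open import Data.Product using (Σ; ∃; ∃₂; _×_; _,_; proj₁; proj₂)
open import Data.Rational as ℚ using (ℚ; mkℚ; ↥_; ↧ₙ_; 0ℚ; 1ℚ)
import Data.Rational.Properties as ℚₚ
open import Data.Sum using (_⊎_; inj₁; inj₂; [_,_]′)
open import Function.Base using (_∘_)
open import Function.Bundles using (_⇔_; mk⇔; Equivalence)
open import Function.Properties.Equivalence using () renaming (refl to ⇔-refl; trans to ⇔-trans)
open import Relation.Nullary using (¬_; yes; no)
open import Relation.Unary using (Decidable)
open import Relation.Binary.PropositionalEquality
open import Defs

Least : (ℕ → Set) → ℕ → Set
Least P m = P m × (∀ k → k < m → ¬ P k)

∃⇒∃-least : ∀ {P : ℕ → Set} → Decidable P → ∃ P → ∃ (Least P)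
∃⇒∃-least {P} P? (w , Pw) = <-rec (λ w → P w → ∃ (Least P)) search w Pw
  where
  search : ∀ w → (∀ {v} → v < w → P v → ∃ (Least P)) → P w → ∃ (Least P)
  search w below Pw with Finₚ.any? (λ (i : Fin w) → P? (toℕ i))
  ... | yes (i , Pi) = below (Finₚ.toℕ<n i) Pi
  ... | no none = w , Pw , λ k k<w Pk →
    none (fromℕ< k<w , subst P (sym (Finₚ.toℕ-fromℕ< k<w)) Pk)

∃-prime-divisor : ∀ n .{{_ : NonZero n}} → n ≢ 1 → ∃ λ p → Prime p × p ∣ n
∃-prime-divisor n n≢1 with factorise n
... | record { factors = [] ; isFactorisation = n≡1 } = ⊥-elim (n≢1 n≡1)
... | record { factors = p ∷ ps ; isFactorisation = n≡p*ps ; factorsPrime = p-prime ∷ _ } =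
  p , p-prime , subst (p ∣_) (sym n≡p*ps) (m∣m*n _)

≐-trans : ∀ {A B C : Subset} → A ≐ B → B ≐ C → A ≐ C
≐-trans A≐B B≐C n =
  (λ a → proj₁ (B≐C n) (proj₁ (A≐B n) a)) , (λ c → proj₂ (A≐B n) (proj₂ (B≐C n) c))

coprime-∣ℤ*⇒∣ℤ : ∀ {b} c x → Coprime b ℤ.∣ c ∣ → + b ∣ℤ c ℤ.* x → + b ∣ℤ x
coprime-∣ℤ*⇒∣ℤ {b} c x b⊥c b∣cx =
  ℤ∣.∣ᵤ⇒∣ (coprime-divisor b⊥c (subst (b ∣_) (ℤₚ.abs-* c x) (ℤ∣.∣⇒∣ᵤ b∣cx)))

residue : ∀ b .{{_ : NonZero b}} → ℤ → Fin b
residue b x = fromℕ< (ℤ.n%ℕd<d x b)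

residue-≡⇒∣- : ∀ b .{{_ : NonZero b}} x y → residue b x ≡ residue b y → + b ∣ℤ x ℤ.- y
residue-≡⇒∣- b x y same = ℤ∣.divides (x /ℕ b ℤ.- y /ℕ b) (begin
  x ℤ.- y
    ≡⟨ cong₂ ℤ._-_ (ℤ.a≡a%ℕn+[a/ℕn]*n x b) (ℤ.a≡a%ℕn+[a/ℕn]*n y b) ⟩
  (+ (x %ℕ b) ℤ.+ x /ℕ b ℤ.* + b) ℤ.- (+ (y %ℕ b) ℤ.+ y /ℕ b ℤ.* + b)
    ≡⟨ cong (λ r → (+ r ℤ.+ x /ℕ b ℤ.* + b) ℤ.- (+ (y %ℕ b) ℤ.+ y /ℕ b ℤ.* + b)) same-rem ⟩
  (+ (y %ℕ b) ℤ.+ x /ℕ b ℤ.* + b) ℤ.- (+ (y %ℕ b) ℤ.+ y /ℕ b ℤ.* + b)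
    ≡⟨ cancel-remainder (+ (y %ℕ b)) (x /ℕ b) (y /ℕ b) (+ b) ⟩
  (x /ℕ b ℤ.- y /ℕ b) ℤ.* + b ∎)
  where
  open ≡-Reasoning
  same-rem : x %ℕ b ≡ y %ℕ b
  same-rem = Finₚ.fromℕ<-injective _ _ (ℤ.n%ℕd<d x b) (ℤ.n%ℕd<d y b) same
  cancel-remainder : ∀ r q q′ d → (r ℤ.+ q ℤ.* d) ℤ.- (r ℤ.+ q′ ℤ.* d) ≡ (q ℤ.- q′) ℤ.* d
  cancel-remainder = solve-∀

∃-congruent-pair : ∀ b .{{_ : NonZero b}} (f g : ℕ → ℤ) →
  ∃₂ λ i k → + b ∣ℤ f (i ℕ.+ suc k) ℤ.- f i × + b ∣ℤ g (i ℕ.+ suc k) ℤ.- g i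
∃-congruent-pair b f g = collision (Finₚ.pigeonhole (ℕₚ.n<1+n (b ℕ.* b)) residuePair)
  where
  residuePair : Fin (suc (b ℕ.* b)) → Fin (b ℕ.* b)
  residuePair n = combine (residue b (f (toℕ n))) (residue b (g (toℕ n)))
  collision : ∃₂ (λ i j → i Fin.< j × residuePair i ≡ residuePair j) →
    ∃₂ λ i k → + b ∣ℤ f (i ℕ.+ suc k) ℤ.- f i × + b ∣ℤ g (i ℕ.+ suc k) ℤ.- g i
  collision (i , j , i<j , same)
    with same-f , same-g ← Finₚ.combine-injective _ _ _ _ same
    with k , i+1+k≡j ← ℕₚ.m≤n⇒∃[o]m+o≡n i<j
    = toℕ i , k
    , subst (λ n → + b ∣ℤ f n ℤ.- f (toℕ i)) j≡
        (residue-≡⇒∣- b (f (toℕ j)) (f (toℕ i)) (sym same-f))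
    , subst (λ n → + b ∣ℤ g n ℤ.- g (toℕ i)) j≡
        (residue-≡⇒∣- b (g (toℕ j)) (g (toℕ i)) (sym same-g))
    where
    j≡ : toℕ j ≡ toℕ i ℕ.+ suc k
    j≡ = sym (trans (ℕₚ.+-suc (toℕ i) k) i+1+k≡j)

toℚ≡mkℚ : ∀ z → toℚ z ≡ mkℚ z 0 (Coprimality.sym (Coprimality.1-coprimeTo ℤ.∣ z ∣))
toℚ≡mkℚ z = ℚₚ.↥p/↧p≡p (mkℚ z 0 _)

↧ₙ-/*gcd : ∀ i n .{{_ : NonZero n}} → ↧ₙ (i ℚ./ n) ℕ.* gcd ℤ.∣ i ∣ n ≡ n
↧ₙ-/*gcd i n =
  trans (sym (ℤₚ.abs-* (ℚ.↧ (i ℚ./ n)) (Data.Integer.GCD.gcd i (+ n)))) (cong ℤ.∣_∣ (ℚₚ.↧-/ i n))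

↧ₙ-1/n : ∀ n .{{_ : NonZero n}} → ↧ₙ (+ 1 ℚ./ n) ≡ n
↧ₙ-1/n n = trans (sym (ℕₚ.*-identityʳ _))
  (subst (λ g → ↧ₙ (+ 1 ℚ./ n) ℕ.* g ≡ n) (gcd-zeroˡ n) (↧ₙ-/*gcd (+ 1) n))

isInt-/⇔∣ : ∀ i n .{{_ : NonZero n}} → IsInt (i ℚ./ n) ⇔ n ∣ ℤ.∣ i ∣
isInt-/⇔∣ i n = mk⇔
  (λ den≡1 → subst (_∣ ℤ.∣ i ∣) (gcd≡n den≡1) (gcd[m,n]∣m ℤ.∣ i ∣ n))
  (λ n∣i → ℕₚ.*-cancelʳ-≡ _ 1 n (trans (den*n≡n n∣i) (sym (ℕₚ.*-identityˡ n))))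
  where
  gcd≡n : IsInt (i ℚ./ n) → gcd ℤ.∣ i ∣ n ≡ n
  gcd≡n den≡1 = trans (sym (ℕₚ.*-identityˡ _))
    (subst (λ d → d ℕ.* gcd ℤ.∣ i ∣ n ≡ n) den≡1 (↧ₙ-/*gcd i n))
  den*n≡n : n ∣ ℤ.∣ i ∣ → ↧ₙ (i ℚ./ n) ℕ.* n ≡ n
  den*n≡n n∣i = subst (λ g → ↧ₙ (i ℚ./ n) ℕ.* g ≡ n)
    (∣-antisym (gcd[m,n]∣n ℤ.∣ i ∣ n) (gcd-greatest n∣i ∣-refl)) (↧ₙ-/*gcd i n)

toℚ*≡/ : ∀ z R → toℚ z ℚ.* R ≡ (z ℤ.* ↥ R) ℚ./ ↧ₙ R
toℚ*≡/ z R@record{} =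
  trans (cong (ℚ._* R) (toℚ≡mkℚ z)) (ℚₚ./-cong {p₁ = z ℤ.* ↥ R} refl (ℕₚ.*-identityˡ (↧ₙ R)))

↧ₙ-coprime-↥ : ∀ R → Coprime (↧ₙ R) ℤ.∣ ↥ R ∣
↧ₙ-coprime-↥ (mkℚ _ _ c) = Coprimality.sym (Coprimality.recompute c)

isInt-toℚ*⇔∣ : ∀ z R → IsInt (toℚ z ℚ.* R) ⇔ ↧ₙ R ∣ ℤ.∣ z ∣
isInt-toℚ*⇔∣ z R = mk⇔
  (λ int → coprime-divisor (↧ₙ-coprime-↥ R)
    (subst (↧ₙ R ∣_) (trans (ℤₚ.abs-* z (↥ R)) (ℕₚ.*-comm ℤ.∣ z ∣ _))
      (to (subst IsInt (toℚ*≡/ z R) int))))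
  (λ R∣z → subst IsInt (sym (toℚ*≡/ z R))
    (from (subst (↧ₙ R ∣_) (sym (ℤₚ.abs-* z (↥ R))) (∣m⇒∣m*n _ R∣z))))
  where open Equivalence (isInt-/⇔∣ (z ℤ.* ↥ R) (↧ₙ R))

module Lucas (P Q : ℤ) where

  private
    u : ℕ → ℤ
    u = U P Q

  Recurrent : (ℕ → ℤ) → Set
  Recurrent x = ∀ n → x (suc (suc n)) ≡ P ℤ.* x (suc n) ℤ.- Q ℤ.* x n

  U-recurrent : Recurrent u
  U-recurrent n = refl

  shift-recurrent : ∀ {x} → Recurrent x → ∀ k → Recurrent (λ n → x (n ℕ.+ k))
  shift-recurrent rec k n = rec (n ℕ.+ k)

  sub-recurrent : ∀ {x y} → Recurrent x → Recurrent y → Recurrent (λ n → x n ℤ.- y n)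
  sub-recurrent {x} {y} rec-x rec-y n = begin
    x (suc (suc n)) ℤ.- y (suc (suc n))
      ≡⟨ cong₂ ℤ._-_ (rec-x n) (rec-y n) ⟩
    (P ℤ.* x (suc n) ℤ.- Q ℤ.* x n) ℤ.- (P ℤ.* y (suc n) ℤ.- Q ℤ.* y n)
      ≡⟨ regroup P Q (x (suc n)) (x n) (y (suc n)) (y n) ⟩
    P ℤ.* (x (suc n) ℤ.- y (suc n)) ℤ.- Q ℤ.* (x n ℤ.- y n) ∎
    where
    open ≡-Reasoning
    regroup : ∀ P Q a a′ b b′ →
      (P ℤ.* a ℤ.- Q ℤ.* a′) ℤ.- (P ℤ.* b ℤ.- Q ℤ.* b′) ≡ P ℤ.* (a ℤ.- b) ℤ.- Q ℤ.* (a′ ℤ.- b′)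
    regroup = solve-∀

  recurrent-∣-descend : ∀ {b x} → Coprime b ℤ.∣ Q ∣ → Recurrent x →
    ∀ i → + b ∣ℤ x i → + b ∣ℤ x (suc i) → + b ∣ℤ x 0 × + b ∣ℤ x 1
  recurrent-∣-descend b⊥Q rec zero b∣x₀ b∣x₁ = b∣x₀ , b∣x₁
  recurrent-∣-descend {b} {x} b⊥Q rec (suc i) b∣xᵢ₊₁ b∣xᵢ₊₂ =
    recurrent-∣-descend b⊥Q rec i (coprime-∣ℤ*⇒∣ℤ Q (x i) b⊥Q b∣Qxᵢ) b∣xᵢ₊₁
    where
    b∣Qxᵢ : + b ∣ℤ Q ℤ.* x i
    b∣Qxᵢ = subst (+ b ∣ℤ_) (isolate P Q (x (suc i)) (x i))
      (ℤ∣.∣m∣n⇒∣m-n (ℤ∣.∣n⇒∣m*n P b∣xᵢ₊₁) (subst (+ b ∣ℤ_) (rec i) b∣xᵢ₊₂))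
      where
      isolate : ∀ P Q a a′ → P ℤ.* a ℤ.- (P ℤ.* a ℤ.- Q ℤ.* a′) ≡ Q ℤ.* a′
      isolate = solve-∀

  U-+ : ∀ m n → u (suc (m ℕ.+ n)) ≡ u (suc m) ℤ.* u (suc n) ℤ.- Q ℤ.* u m ℤ.* u n
  U-+ zero n = base Q (u (suc n)) (u n)
    where
    base : ∀ Q a a′ → a ≡ ℤ.1ℤ ℤ.* a ℤ.- Q ℤ.* ℤ.0ℤ ℤ.* a′
    base = solve-∀
  U-+ (suc m) n = begin
    u (suc (suc m ℕ.+ n))
      ≡⟨ cong (u ∘ suc) (sym (ℕₚ.+-suc m n)) ⟩
    u (suc (m ℕ.+ suc n))
      ≡⟨ U-+ m (suc n) ⟩
    u (suc m) ℤ.* (P ℤ.* u (suc n) ℤ.- Q ℤ.* u n) ℤ.- Q ℤ.* u m ℤ.* u (suc n)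
      ≡⟨ regroup P Q (u (suc m)) (u m) (u (suc n)) (u n) ⟩
    (P ℤ.* u (suc m) ℤ.- Q ℤ.* u m) ℤ.* u (suc n) ℤ.- Q ℤ.* u (suc m) ℤ.* u n ∎
    where
    open ≡-Reasoning
    regroup : ∀ P Q a a′ c c′ →
      a ℤ.* (P ℤ.* c ℤ.- Q ℤ.* c′) ℤ.- Q ℤ.* a′ ℤ.* c
        ≡ (P ℤ.* a ℤ.- Q ℤ.* a′) ℤ.* c ℤ.- Q ℤ.* a ℤ.* c′
    regroup = solve-∀

  consecutive-∣U⇒≡1 : ∀ {d} → Coprime d ℤ.∣ Q ∣ → ∀ k → + d ∣ℤ u k → + d ∣ℤ u (suc k) → d ≡ 1
  consecutive-∣U⇒≡1 d⊥Q k d∣uₖ d∣uₖ₊₁ =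
    ∣1⇒≡1 (ℤ∣.∣⇒∣ᵤ (proj₂ (recurrent-∣-descend {x = u} d⊥Q U-recurrent k d∣uₖ d∣uₖ₊₁)))

  coprime-U : ∀ {b} → Coprime b ℤ.∣ Q ∣ → ∀ k → + b ∣ℤ u (suc k) → Coprime b ℤ.∣ u k ∣
  coprime-U b⊥Q k b∣uₖ₊₁ {d} (d∣b , d∣uₖ) =
    consecutive-∣U⇒≡1 d⊥Q k (ℤ∣.∣ᵤ⇒∣ d∣uₖ) (ℤ∣.∣-trans (ℤ∣.∣ᵤ⇒∣ d∣b) b∣uₖ₊₁)
    where
    d⊥Q : Coprime d ℤ.∣ Q ∣
    d⊥Q (e∣d , e∣Q) = b⊥Q (∣-trans e∣d d∣b , e∣Q)

  ∃-∣U[1+] : ∀ b .{{_ : NonZero b}} → Coprime b ℤ.∣ Q ∣ → ∃ λ k → + b ∣ℤ u (suc k)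
  ∃-∣U[1+] b b⊥Q = period (∃-congruent-pair b u (u ∘ suc))
    where
    period : (∃₂ λ i k → + b ∣ℤ u (i ℕ.+ suc k) ℤ.- u i
                       × + b ∣ℤ u (suc (i ℕ.+ suc k)) ℤ.- u (suc i)) →
             ∃ λ k → + b ∣ℤ u (suc k)
    period (i , k , b∣Δuᵢ , b∣Δuᵢ₊₁) =
      k , subst (+ b ∣ℤ_) Δ₀≡ (proj₁ (recurrent-∣-descend {x = Δ} b⊥Q Δ-recurrent i b∣Δuᵢ b∣Δuᵢ₊₁))
      where
      Δ : ℕ → ℤ
      Δ n = u (n ℕ.+ suc k) ℤ.- u n
      Δ-recurrent : Recurrent Δ
      Δ-recurrent = sub-recurrent (shift-recurrent U-recurrent (suc k)) U-recurrent
      Δ₀≡ : Δ 0 ≡ u (suc k)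
      Δ₀≡ = ℤₚ.+-identityʳ (u (suc k))

  DividesU : ℕ → Subset
  DividesU b n = + b ∣ℤ u n

  module _ {b} (b⊥Q : Coprime b ℤ.∣ Q ∣) {m} (b∣uₘ₊₁ : + b ∣ℤ u (suc m)) where

    -- U (1+m+n) ≡ - Q · U m · U n (mod b), and b is coprime to both Q and U m.
    ∣U[1+m+n]⇔∣U[n] : ∀ n → + b ∣ℤ u (suc m ℕ.+ n) ⇔ + b ∣ℤ u n
    ∣U[1+m+n]⇔∣U[n] n = mk⇔
      (λ b∣uₘ₊ₙ₊₁ → coprime-∣ℤ*⇒∣ℤ (u m) (u n) (coprime-U b⊥Q m b∣uₘ₊₁)
        (coprime-∣ℤ*⇒∣ℤ Q (u m ℤ.* u n) b⊥Q
          (subst (+ b ∣ℤ_) (isolate lead Q (u m) (u n))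
            (ℤ∣.∣m∣n⇒∣m-n b∣lead (subst (+ b ∣ℤ_) (U-+ m n) b∣uₘ₊ₙ₊₁)))))
      (λ b∣uₙ → subst (+ b ∣ℤ_) (sym (U-+ m n))
        (ℤ∣.∣m∣n⇒∣m-n b∣lead (ℤ∣.∣n⇒∣m*n (Q ℤ.* u m) b∣uₙ)))
      where
      lead : ℤ
      lead = u (suc m) ℤ.* u (suc n)
      b∣lead : + b ∣ℤ lead
      b∣lead = ℤ∣.∣m⇒∣m*n (u (suc n)) b∣uₘ₊₁
      isolate : ∀ t q a c → t ℤ.- (t ℤ.- q ℤ.* a ℤ.* c) ≡ q ℤ.* (a ℤ.* c)
      isolate = solve-∀

    ∣U[q*[1+m]+n]⇔∣U[n] : ∀ q n → + b ∣ℤ u (q ℕ.* suc m ℕ.+ n) ⇔ + b ∣ℤ u n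
    ∣U[q*[1+m]+n]⇔∣U[n] zero n = ⇔-refl
    ∣U[q*[1+m]+n]⇔∣U[n] (suc q) n rewrite ℕₚ.+-assoc (suc m) (q ℕ.* suc m) n =
      ⇔-trans (∣U[1+m+n]⇔∣U[n] (q ℕ.* suc m ℕ.+ n)) (∣U[q*[1+m]+n]⇔∣U[n] q n)

    module _ (b∤uₖ₊₁ : ∀ k → k < m → ¬ (+ b ∣ℤ u (suc k))) where

      ∣U[r]⇒r≡0 : ∀ r → r < suc m → + b ∣ℤ u r → r ≡ 0
      ∣U[r]⇒r≡0 zero    _             _      = refl
      ∣U[r]⇒r≡0 (suc k) (s≤s k<m) b∣uₖ₊₁ = ⊥-elim (b∤uₖ₊₁ k k<m b∣uₖ₊₁)

      DividesU≐Mult : DividesU b ≐ Mult (suc m)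
      DividesU≐Mult n = divisible⇒multiple , multiple⇒divisible
        where
        open Equivalence
        divisible⇒multiple : + b ∣ℤ u n → suc m ∣ n
        divisible⇒multiple b∣uₙ = m%n≡0⇒n∣m n (suc m) (∣U[r]⇒r≡0 (n % suc m) (m%n<n n (suc m))
          (to (∣U[q*[1+m]+n]⇔∣U[n] (n / suc m) (n % suc m)) (subst (λ k → + b ∣ℤ u k) n≡ b∣uₙ)))
          where
          n≡ : n ≡ n / suc m ℕ.* suc m ℕ.+ n % suc m
          n≡ = trans (m≡m%n+[m/n]*n n (suc m)) (ℕₚ.+-comm (n % suc m) _)
        multiple⇒divisible : suc m ∣ n → + b ∣ℤ u n
        multiple⇒divisible (divides q refl) =
          subst (λ k → + b ∣ℤ u k) (ℕₚ.+-identityʳ (q ℕ.* suc m))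
          (from (∣U[q*[1+m]+n]⇔∣U[n] q 0) (ℤ∣.∣ᵤ⇒∣ (b ∣0)))

  ∃-DividesU≐Mult : ∀ b .{{_ : NonZero b}} → Coprime b ℤ.∣ Q ∣ → ∃ λ m → DividesU b ≐ Mult (suc m)
  ∃-DividesU≐Mult b b⊥Q = rank (∃⇒∃-least (λ k → + b ℤ∣.∣? u (suc k)) (∃-∣U[1+] b b⊥Q))
    where
    rank : ∃ (Least (λ k → + b ∣ℤ u (suc k))) → ∃ λ m → DividesU b ≐ Mult (suc m)
    rank (m , b∣uₘ₊₁ , b∤uₖ₊₁) = m , DividesU≐Mult b⊥Q b∣uₘ₊₁ b∤uₖ₊₁

  prime-∤U[1+] : ∀ {p} → Prime p → p ∣ ℤ.∣ Q ∣ → ¬ (p ∣ ℤ.∣ P ∣) → ∀ n → ¬ (+ p ∣ℤ u (suc n))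
  prime-∤U[1+] p-prime _ _ zero p∣1 = ¬prime[1] (subst Prime (∣1⇒≡1 (ℤ∣.∣⇒∣ᵤ p∣1)) p-prime)
  prime-∤U[1+] {p} p-prime p∣Q p∤P (suc n) p∣uₙ₊₂ =
    [ p∤P , prime-∤U[1+] p-prime p∣Q p∤P n ∘ ℤ∣.∣ᵤ⇒∣ ]′
      (euclidsLemma ℤ.∣ P ∣ ℤ.∣ u (suc n) ∣ p-prime
        (subst (p ∣_) (ℤₚ.abs-* P (u (suc n))) (ℤ∣.∣⇒∣ᵤ p∣Puₙ₊₁)))
    where
    p∣Puₙ₊₁ : + p ∣ℤ P ℤ.* u (suc n)
    p∣Puₙ₊₁ = subst (+ p ∣ℤ_) (restore P Q (u (suc n)) (u n))
      (ℤ∣.∣m∣n⇒∣m+n p∣uₙ₊₂ (ℤ∣.∣m⇒∣m*n (u n) (ℤ∣.∣ᵤ⇒∣ {+ p} {Q} p∣Q)))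
      where
      restore : ∀ P Q a a′ → (P ℤ.* a ℤ.- Q ℤ.* a′) ℤ.+ Q ℤ.* a′ ≡ P ℤ.* a
      restore = solve-∀

  DividesU≐Zero : ∀ {b p} → Prime p → p ∣ b → p ∣ ℤ.∣ Q ∣ → ¬ (p ∣ ℤ.∣ P ∣) → DividesU b ≐ Zero
  DividesU≐Zero {b} _ _ _ _ zero = (λ _ → refl) , (λ _ → ℤ∣.∣ᵤ⇒∣ (b ∣0))
  DividesU≐Zero p-prime p∣b p∣Q p∤P (suc n) =
    (λ b∣uₙ₊₁ → ⊥-elim (prime-∤U[1+] p-prime p∣Q p∤P n (ℤ∣.∣-trans (ℤ∣.∣ᵤ⇒∣ p∣b) b∣uₙ₊₁))) , λ ()

𝓛≐DividesU : ∀ P Q R → 𝓛 P Q R ≐ Lucas.DividesU P Q (↧ₙ R)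
𝓛≐DividesU P Q R n = (λ int → ℤ∣.∣ᵤ⇒∣ (to int)) , (λ R∣Uₙ → from (ℤ∣.∣⇒∣ᵤ R∣Uₙ))
  where open Equivalence (isInt-toℚ*⇔∣ (U P Q n) R)

𝓛-classification : ∀ P Q R → ¬ IsInt R →
  (∀ p → Prime p → p ∣ ↧ₙ R → ¬ (p ∣ gcd ℤ.∣ P ∣ ℤ.∣ Q ∣)) →
  (𝓛 P Q R ≐ Zero) ⊎ Σ ℕ (λ m → (2 ≤ m) × (𝓛 P Q R ≐ Mult m))
𝓛-classification P Q R R∉ℤ regular with coprime? (↧ₙ R) ℤ.∣ Q ∣
... | yes b⊥Q = inj₂ (multiples (Lucas.∃-DividesU≐Mult P Q (↧ₙ R) b⊥Q))
  where
  multiples : ∃ (λ m → Lucas.DividesU P Q (↧ₙ R) ≐ Mult (suc m)) →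
    Σ ℕ (λ m → (2 ≤ m) × (𝓛 P Q R ≐ Mult m))
  multiples (zero , b∣U⇔1∣) = ⊥-elim (R∉ℤ (∣1⇒≡1 (ℤ∣.∣⇒∣ᵤ (proj₂ (b∣U⇔1∣ 1) ∣-refl))))
  multiples (suc m , b∣U⇔) = suc (suc m) , s≤s (s≤s z≤n) , ≐-trans (𝓛≐DividesU P Q R) b∣U⇔
... | no ¬b⊥Q = inj₁ (trivial (∃-prime-divisor g (λ g≡1 → ¬b⊥Q (gcd≡1⇒coprime g≡1))))
  where
  g : ℕ
  g = gcd (↧ₙ R) ℤ.∣ Q ∣
  instance
    g≢0 : NonZero g
    g≢0 = ℕ.≢-nonZero (gcd[m,n]≢0 (↧ₙ R) ℤ.∣ Q ∣ (inj₁ λ ()))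
  trivial : (∃ λ p → Prime p × p ∣ g) → 𝓛 P Q R ≐ Zero
  trivial (p , p-prime , p∣g) = ≐-trans (𝓛≐DividesU P Q R)
    (Lucas.DividesU≐Zero P Q p-prime p∣b p∣Q (λ p∣P → regular p p-prime p∣b (gcd-greatest p∣P p∣Q)))
    where
    p∣b : p ∣ ↧ₙ R
    p∣b = ∣-trans p∣g (gcd[m,n]∣m (↧ₙ R) ℤ.∣ Q ∣)
    p∣Q : p ∣ ℤ.∣ Q ∣
    p∣Q = ∣-trans p∣g (gcd[m,n]∣n (↧ₙ R) ℤ.∣ Q ∣)

IntegralMultiples : ℚ → Subset
IntegralMultiples c n = IsInt (toℚ (+ n) ℚ.* c)

IntegralMultiples-1/m≐Mult : ∀ m .{{_ : NonZero m}} → IntegralMultiples (+ 1 ℚ./ m) ≐ Mult m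
IntegralMultiples-1/m≐Mult m n =
  (λ int → subst (_∣ n) (↧ₙ-1/n m) (to int)) , (λ m∣n → from (subst (_∣ n) (sym (↧ₙ-1/n m)) m∣n))
  where open Equivalence (isInt-toℚ*⇔∣ (+ n) (+ 1 ℚ./ m))

prime∤1 : ∀ {p} → Prime p → ¬ (p ∣ 1)
prime∤1 p-prime p∣1 = ¬prime[1] (subst Prime (∣1⇒≡1 p∣1) p-prime)

arises-Zero : Arises Zero
arises-Zero = + 1 , + 2 , + 1 ℚ./ 2 , ((λ ()) , (λ ()) , λ _ p-prime _ → prime∤1 p-prime) ,
  ≐-trans (𝓛≐DividesU (+ 1) (+ 2) (+ 1 ℚ./ 2))
    (Lucas.DividesU≐Zero (+ 1) (+ 2) prime[2] ∣-refl ∣-refl (prime∤1 prime[2]))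

U[2,1]≡id : ∀ n → U (+ 2) (+ 1) n ≡ + n
U[2,1]≡id zero = refl
U[2,1]≡id (suc zero) = refl
U[2,1]≡id (suc (suc n)) = begin
  + 2 ℤ.* U (+ 2) (+ 1) (suc n) ℤ.- + 1 ℤ.* U (+ 2) (+ 1) n
    ≡⟨ cong₂ (λ a b → + 2 ℤ.* a ℤ.- + 1 ℤ.* b) (U[2,1]≡id (suc n)) (U[2,1]≡id n) ⟩
  + 2 ℤ.* (+ 1 ℤ.+ + n) ℤ.- + 1 ℤ.* + n
    ≡⟨ linear (+ n) ⟩
  + 2 ℤ.+ + n ∎
  where
  open ≡-Reasoning
  linear : ∀ x → + 2 ℤ.* (+ 1 ℤ.+ x) ℤ.- + 1 ℤ.* x ≡ + 2 ℤ.+ x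
  linear = solve-∀

arises-Mult : ∀ m .{{_ : NonZero m}} → m ≢ 1 → Arises (Mult m)
arises-Mult m m≢1 = + 2 , + 1 , + 1 ℚ./ m ,
  ((λ ()) , (λ den≡1 → m≢1 (trans (sym (↧ₙ-1/n m)) den≡1)) , λ _ p-prime _ → prime∤1 p-prime) ,
  ≐-trans 𝓛≐IntegralMultiples (IntegralMultiples-1/m≐Mult m)
  where
  𝓛≐IntegralMultiples : 𝓛 (+ 2) (+ 1) (+ 1 ℚ./ m) ≐ IntegralMultiples (+ 1 ℚ./ m)
  𝓛≐IntegralMultiples n =
    subst (λ z → IsInt (toℚ z ℚ.* (+ 1 ℚ./ m))) (U[2,1]≡id n) ,
    subst (λ z → IsInt (toℚ z ℚ.* (+ 1 ℚ./ m))) (sym (U[2,1]≡id n))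

sumFin-cong : ∀ {d} {f g : Fin d → ℚ} → (∀ i → f i ≡ g i) → sumFin f ≡ sumFin g
sumFin-cong {zero}  f≗g = refl
sumFin-cong {suc d} f≗g = cong₂ ℚ._+_ (f≗g zero) (sumFin-cong (λ i → f≗g (suc i)))

⊗-congʳ : ∀ {d} (A : Mat d) {B C : Mat d} →
  (∀ i j → B i j ≡ C i j) → ∀ i j → (A ⊗ B) i j ≡ (A ⊗ C) i j
⊗-congʳ A B≗C i j = sumFin-cong (λ k → cong (A i k ℚ.*_) (B≗C k j))

unitriangular : ℚ → Mat 2
unitriangular c zero       zero       = 1ℚ
unitriangular c zero       (suc zero) = c
unitriangular c (suc zero) zero       = 0ℚ
unitriangular c (suc zero) (suc zero) = 1ℚ

unitriangular-⊗ : ∀ a b i j → (unitriangular a ⊗ unitriangular b) i j ≡ unitriangular (a ℚ.+ b) i j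
unitriangular-⊗ a b zero       zero       = cong (λ x → 1ℚ ℚ.* 1ℚ ℚ.+ (x ℚ.+ 0ℚ)) (ℚₚ.*-zeroʳ a)
unitriangular-⊗ a b zero       (suc zero) = begin
  1ℚ ℚ.* b ℚ.+ (a ℚ.* 1ℚ ℚ.+ 0ℚ) ≡⟨ cong₂ ℚ._+_ (ℚₚ.*-identityˡ b) (ℚₚ.+-identityʳ (a ℚ.* 1ℚ)) ⟩
  b ℚ.+ a ℚ.* 1ℚ                  ≡⟨ cong (b ℚ.+_) (ℚₚ.*-identityʳ a) ⟩
  b ℚ.+ a                         ≡⟨ ℚₚ.+-comm b a ⟩
  a ℚ.+ b                         ∎
  where open ≡-Reasoning
unitriangular-⊗ a b (suc zero) zero       = refl
unitriangular-⊗ a b (suc zero) (suc zero) = cong (λ x → x ℚ.+ (1ℚ ℚ.* 1ℚ ℚ.+ 0ℚ)) (ℚₚ.*-zeroˡ b)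

toℚ-suc : ∀ n → toℚ (+ suc n) ≡ 1ℚ ℚ.+ toℚ (+ n)
toℚ-suc n = sym (trans (cong (1ℚ ℚ.+_) (toℚ≡mkℚ (+ n))) (ℚₚ./-cong {q₁ = 1} (unit (+ n)) refl))
  where
  unit : ∀ x → ℤ.1ℤ ℤ.* ℤ.1ℤ ℤ.+ x ℤ.* ℤ.1ℤ ≡ ℤ.1ℤ ℤ.+ x
  unit = solve-∀

unitriangular-^ : ∀ c n i j → (unitriangular c ^ᴹ n) i j ≡ unitriangular (toℚ (+ n) ℚ.* c) i j
unitriangular-^ c zero zero       zero       = refl
unitriangular-^ c zero zero       (suc zero) = sym (ℚₚ.*-zeroˡ c)
unitriangular-^ c zero (suc zero) zero       = refl
unitriangular-^ c zero (suc zero) (suc zero) = refl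
unitriangular-^ c (suc n) i j = begin
  (unitriangular c ⊗ (unitriangular c ^ᴹ n)) i j
    ≡⟨ ⊗-congʳ (unitriangular c) (unitriangular-^ c n) i j ⟩
  (unitriangular c ⊗ unitriangular (toℚ (+ n) ℚ.* c)) i j
    ≡⟨ unitriangular-⊗ c (toℚ (+ n) ℚ.* c) i j ⟩
  unitriangular (c ℚ.+ toℚ (+ n) ℚ.* c) i j
    ≡⟨ cong (λ x → unitriangular x i j) c+nc≡[1+n]c ⟩
  unitriangular (toℚ (+ suc n) ℚ.* c) i j ∎
  where
  open ≡-Reasoning
  c+nc≡[1+n]c : c ℚ.+ toℚ (+ n) ℚ.* c ≡ toℚ (+ suc n) ℚ.* c
  c+nc≡[1+n]c = begin
    c ℚ.+ toℚ (+ n) ℚ.* c       ≡⟨ cong (ℚ._+ toℚ (+ n) ℚ.* c) (sym (ℚₚ.*-identityˡ c)) ⟩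
    1ℚ ℚ.* c ℚ.+ toℚ (+ n) ℚ.* c ≡⟨ sym (ℚₚ.*-distribʳ-+ c 1ℚ (toℚ (+ n))) ⟩
    (1ℚ ℚ.+ toℚ (+ n)) ℚ.* c     ≡⟨ cong (ℚ._* c) (sym (toℚ-suc n)) ⟩
    toℚ (+ suc n) ℚ.* c          ∎

𝓢-unitriangular : ∀ c → 𝓢 (unitriangular c) ≐ IntegralMultiples c
𝓢-unitriangular c n =
  (λ int → subst IsInt (unitriangular-^ c n zero (suc zero)) (int zero (suc zero))) , entries
  where
  entries : IntegralMultiples c n → 𝓢 (unitriangular c) n
  entries int i j = subst IsInt (sym (unitriangular-^ c n i j)) (entry i j)
    where
    entry : ∀ i j → IsInt (unitriangular (toℚ (+ n) ℚ.* c) i j)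
    entry zero       zero       = refl
    entry zero       (suc zero) = int
    entry (suc zero) zero       = refl
    entry (suc zero) (suc zero) = refl

realizable-Mult : ∀ m .{{_ : NonZero m}} → Realizable 2 (Mult m)
realizable-Mult m = unitriangular (+ 1 ℚ./ m) , λ n →
  let (to₁ , from₁) = IntegralMultiples-1/m≐Mult m n
      (to₂ , from₂) = 𝓢-unitriangular (+ 1 ℚ./ m) n
  in from₂ ∘ from₁ , to₁ ∘ to₂

idempotent : Mat 2
idempotent zero       zero       = 1ℚ
idempotent zero       (suc zero) = + 1 ℚ./ 2
idempotent (suc zero) zero       = 0ℚ
idempotent (suc zero) (suc zero) = 0ℚ

idempotent-^ : ∀ n i j → (idempotent ^ᴹ suc n) i j ≡ idempotent i j
idempotent-^ zero    zero       zero       = refl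
idempotent-^ zero    zero       (suc zero) = refl
idempotent-^ zero    (suc zero) zero       = refl
idempotent-^ zero    (suc zero) (suc zero) = refl
idempotent-^ (suc n) i j = trans (⊗-congʳ idempotent (idempotent-^ n) i j) (square i j)
  where
  square : ∀ i j → (idempotent ⊗ idempotent) i j ≡ idempotent i j
  square zero       zero       = refl
  square zero       (suc zero) = refl
  square (suc zero) zero       = refl
  square (suc zero) (suc zero) = refl

realizable-Zero : Realizable 2 Zero
realizable-Zero = idempotent , λ n → zero∈ n , ∈⇒zero n
  where
  zero∈ : ∀ n → Zero n → 𝓢 idempotent n
  zero∈ .0 refl zero       zero       = refl
  zero∈ .0 refl zero       (suc zero) = refl
  zero∈ .0 refl (suc zero) zero       = refl
  zero∈ .0 refl (suc zero) (suc zero) = refl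
  ∈⇒zero : ∀ n → 𝓢 idempotent n → Zero n
  ∈⇒zero zero    _   = refl
  ∈⇒zero (suc n) int with () ← subst IsInt (idempotent-^ n zero (suc zero)) (int zero (suc zero))

corollary4p2 :
    ((P Q : ℤ) (R : ℚ) → Hyp P Q R →
      (𝓛 P Q R ≐ Zero) ⊎ Σ ℕ (λ m → (2 ≤ m) × (𝓛 P Q R ≐ Mult m)))
    × (Arises Zero × ((m : ℕ) → 2 ≤ m → Arises (Mult m)))
    × (Realizable 2 Zero × ((m : ℕ) → 2 ≤ m → Realizable 2 (Mult m)))
corollary4p2 =
  (λ { P Q R (_ , R∉ℤ , regular) → 𝓛-classification P Q R R∉ℤ regular })
  , (arises-Zero , λ { (suc (suc k)) _ → arises-Mult (suc (suc k)) (λ ()) ; (suc zero) (s≤s ()) })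
  , (realizable-Zero , λ { (suc k) _ → realizable-Mult (suc k) })
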